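{- Let $G=(V,E)$ be a connected graph with at least two vertices. If $\mathrm{evc}(G)=\mathrm{mvc}(G)$, then for every vertex $v\in V$, $G$ has a minimum vertex cover containing $v$.
   Context: All graphs are finite and simple. $\mathrm{mvc}(G)$ denotes the minimum cardinality of a vertex cover of $G$. Eternal vertex cover game: guards are placed on vertices of $G$, at most one guard per vertex; the set of occupied vertices is a configuration. In each round an attacker chooses an edge $uv$; the defender responds by moving guards simultaneously, each guard either staying put or moving to an adjacent vertex, such that at least one guard moves across the attacked edge, and after the move at most one guard is on each vertex; the number of guards never changes. An eternal vertex cover class of $G$ is a family $\mathcal{C}$ of vertex covers of $G$, all of the same cardinality, such that for every configuration $S\in\mathcal{C}$ and every attacked edge, the attack can be defended by a legal move leading to a configuration in $\mathcal{C}$. The eternal vertex cover number $\mathrm{evc}(G)$ is the minimum cardinality of a configuration of an eternal vertex cover class of $G$. -}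

module Defs where

open import Data.Nat using (ℕ; _≤_)
open import Data.Bool using (Bool; true; false)
open import Data.Fin using (Fin)
open import Data.Fin.Subset using (Subset; _∈_; ∣_∣)
open import Data.Product using (Σ; _×_; ∃; ∃-syntax; _,_)
open import Data.Sum using (_⊎_)
open import Level using (suc; zero)
open import Relation.Binary.PropositionalEquality using (_≡_)

record Graph (n : ℕ) : Set where
  field
    adj     : Fin n → Fin n → Bool
    adj-sym : ∀ u v → adj u v ≡ adj v u
    adj-irr : ∀ u → adj u u ≡ false
open Graph public

Edge : ∀ {n} → Graph n → Fin n → Fin n → Set
Edge G u v = adj G u v ≡ true

data Reach {n : ℕ} (G : Graph n) : Fin n → Fin n → Set where
  here : ∀ {u} → Reach G u u
  step : ∀ {u w v} → Edge G u w → Reach G w v → Reach G u v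

Connected : ∀ {n} → Graph n → Set
Connected G = ∀ u v → Reach G u v

VertexCover : ∀ {n} → Graph n → Subset n → Set
VertexCover G S = ∀ u v → Edge G u v → (u ∈ S) ⊎ (v ∈ S)

MinimumVertexCover : ∀ {n} → Graph n → Subset n → Set
MinimumVertexCover G S =
  VertexCover G S × (∀ T → VertexCover G T → ∣ S ∣ ≤ ∣ T ∣)

IsMvc : ∀ {n} → Graph n → ℕ → Set
IsMvc G k =
  (∃[ S ] (VertexCover G S × ∣ S ∣ ≡ k)) × (∀ S → VertexCover G S → k ≤ ∣ S ∣)

-- A legal defending move from configuration S to configuration S' against
-- an attack on the edge {a , b}: each guard at u ∈ S goes to dest u, which
-- is u itself or a neighbour of u; no two guards end on the same vertex;
-- S' is exactly the set of final guard positions; some guard crosses the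
-- attacked edge.
record Move {n : ℕ} (G : Graph n) (S S' : Subset n) (a b : Fin n) : Set where
  field
    dest      : Fin n → Fin n
    stay-or-adj : ∀ u → u ∈ S → (dest u ≡ u) ⊎ Edge G u (dest u)
    injective : ∀ u w → u ∈ S → w ∈ S → dest u ≡ dest w → u ≡ w
    into      : ∀ u → u ∈ S → dest u ∈ S'
    onto      : ∀ x → x ∈ S' → ∃[ u ] (u ∈ S × dest u ≡ x)
    crosses   : (a ∈ S × dest a ≡ b) ⊎ (b ∈ S × dest b ≡ a)

EVCClass : ∀ {n} → Graph n → (Subset n → Set) → ℕ → Set
EVCClass G C k =
  (∀ S → C S → VertexCover G S × ∣ S ∣ ≡ k) ×
  (∀ S → C S → ∀ a b → Edge G a b → ∃[ S' ] (C S' × Move G S S' a b))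

IsEvc : ∀ {n} → Graph n → ℕ → Set₁
IsEvc {n} G k =
  (Σ (Subset n → Set) λ C → Σ ℕ λ m → EVCClass G C m × ∃[ S ] (C S × ∣ S ∣ ≡ k)) ×
  (∀ (C : Subset n → Set) m → EVCClass G C m → ∀ S → C S → k ≤ ∣ S ∣)

-- Every configuration of an eternal vertex cover class is a vertex cover of
-- size evc(G) = mvc(G), hence a minimum vertex cover. Given v, pick a
-- neighbour w (G is connected with at least two vertices) and attack vw:
-- either v is already guarded, or the guard crossing the edge lands on v.
module Submission where

open import Defs
open import Data.Nat using (ℕ; _≤_; s≤s; z≤n)
open import Data.Nat.Properties using (≤-reflexive; ≤-trans)
open import Data.Fin using (Fin; zero; punchIn)
open import Data.Fin.Properties using (punchInᵢ≢i)
open import Data.Fin.Subset using (Subset; _∈_; ∣_∣)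
open import Data.Product using (_×_; ∃-syntax; _,_; proj₁; proj₂)
open import Data.Sum using (inj₁; inj₂)
open import Relation.Nullary using (contradiction)
open import Relation.Binary.PropositionalEquality using (_≡_; _≢_; refl; sym; trans; subst)

Reach⇒neighbour : ∀ {n} {G : Graph n} {u v} → Reach G u v → u ≢ v → ∃[ w ] Edge G u w
Reach⇒neighbour here               u≢u = contradiction refl u≢u
Reach⇒neighbour (step {w = w} e _) _   = w , e

Connected⇒neighbour : ∀ {n} (G : Graph n) → 2 ≤ n → Connected G →
  ∀ v → ∃[ w ] Edge G v w
Connected⇒neighbour {ℕ.suc (ℕ.suc _)} G (s≤s (s≤s z≤n)) connected v =
  Reach⇒neighbour (connected v (punchIn v zero)) (λ eq → punchInᵢ≢i v zero (sym eq))

EVCClass-minimum : ∀ {n} {G : Graph n} {C : Subset n → Set} {k} →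
  EVCClass G C k → (∀ T → VertexCover G T → k ≤ ∣ T ∣) →
  ∀ S → C S → MinimumVertexCover G S
EVCClass-minimum (covers , _) k≤mvc S S∈C =
  let (S-cover , ∣S∣≡k) = covers S S∈C in
  S-cover , λ T T-cover → ≤-trans (≤-reflexive ∣S∣≡k) (k≤mvc T T-cover)

EVCClass-guards-endpoint : ∀ {n} {G : Graph n} {C : Subset n → Set} {k} →
  EVCClass G C k → ∀ S → C S → ∀ {v w} → Edge G v w →
  ∃[ T ] (C T × v ∈ T)
EVCClass-guards-endpoint (_ , defend) S S∈C {v} {w} e
  with defend S S∈C v w e
... | S′ , S′∈C , move with Move.crosses move
...   | inj₁ (v∈S , _)    = S , S∈C , v∈S
...   | inj₂ (w∈S , w↦v) = S′ , S′∈C , subst (_∈ S′) w↦v (Move.into move w w∈S)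

mainTheorem17 : ∀ {n} (G : Graph n) → 2 ≤ n → Connected G →
    (k : ℕ) → IsMvc G k → IsEvc G k →
    ∀ (v : Fin n) → ∃[ S ] (MinimumVertexCover G S × v ∈ S)
mainTheorem17 G 2≤n connected k (_ , k≤mvc) ((C , m , class , S , S∈C , ∣S∣≡k) , _) v =
  let (_ , e)         = Connected⇒neighbour G 2≤n connected v
      (T , T∈C , v∈T) = EVCClass-guards-endpoint class S S∈C e
      m≡k             = trans (sym (proj₂ (proj₁ class S S∈C))) ∣S∣≡k
      m≤mvc           = λ U U-cover → ≤-trans (≤-reflexive m≡k) (k≤mvc U U-cover)
  in T , EVCClass-minimum class m≤mvc T T∈C , v∈T
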